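{- A small bipointed type $A$ is inductive if and only if it is homotopy-initial, i.e. the type $(\Pi A:\mathsf{Bip})\big(\mathsf{ishinit}(A)\leftrightarrow\mathsf{isind}(A)\big)$ is inhabited, where $X\leftrightarrow Y:=(X\to Y)\times(Y\to X)$.
   Context: Work in the intensional Martin-Löf type theory $\mathcal{H}$ with $\Sigma$-types, $\Pi$-types (with judgemental $\eta$), identity types and a universe $\mathsf{U}$ (à la Russell) closed under $\Sigma,\Pi,\mathsf{Id}$, plus function extensionality; no UIP or equality reflection. $\mathsf{iscontr}(X):=(\Sigma x:X)(\Pi y:X)\mathsf{Id}(x,y)$. A small bipointed type is a triple $(A,a_0,a_1)$ with $A:\mathsf{U}$, $a_0,a_1:A$; $\mathsf{Bip}:=(\Sigma A:\mathsf{U})(A\times A)$. A bipointed morphism $(A,a_0,a_1)\to(B,b_0,b_1)$ is $(f,\bar f_0,\bar f_1)$ with $f:A\to B$, $\bar f_k:\mathsf{Id}(fa_k,b_k)$; $\mathsf{Bip}(A,B)$ is the type of these. $A$ is homotopy-initial if $\mathsf{ishinit}(A):=(\Pi B:\mathsf{Bip})\mathsf{iscontr}(\mathsf{Bip}(A,B))$ is inhabited. A small fibered bipointed type over $A$ is $(E,e_0,e_1)$ with $E:A\to\mathsf{U}$, $e_0:E(a_0)$, $e_1:E(a_1)$; $\mathsf{FibBip}(A)$ is the type of these. A bipointed section of it is $(f,\bar f_0,\bar f_1)$ with $f:(\Pi x:A)E(x)$ and $\bar f_k:\mathsf{Id}_{E(a_k)}(fa_k,e_k)$; $\mathsf{BipSec}(A,E)$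 is the type of these. $A$ is inductive if $\mathsf{isind}(A):=(\Pi E:\mathsf{FibBip}(A))\mathsf{BipSec}(A,E)$ is inhabited. -}

module Defs where

open import Level using (Level; _⊔_)
open import Data.Product using (Σ; Σ-syntax; _×_; _,_)
open import Relation.Binary.PropositionalEquality using (_≡_)

-- Function extensionality (for dependent functions), at all levels.
-- The ambient theory H assumes it; in Agda --without-K we take it as a hypothesis.
FunExt : Set₁
FunExt = {A : Set} {B : A → Set} {f g : (x : A) → B x} →
         ((x : A) → f x ≡ g x) → f ≡ g

iscontr : ∀ {ℓ} → Set ℓ → Set ℓ
iscontr X = Σ[ x ∈ X ] ((y : X) → x ≡ y)

_↔_ : ∀ {a b} → Set a → Set b → Set (a ⊔ b)
X ↔ Y = (X → Y) × (Y → X)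

-- Small bipointed types; the universe U is Set.
Bip : Set₁
Bip = Σ[ A ∈ Set ] (A × A)

BipHom : Bip → Bip → Set
BipHom (A , a₀ , a₁) (B , b₀ , b₁) =
  Σ[ f ∈ (A → B) ] ((f a₀ ≡ b₀) × (f a₁ ≡ b₁))

ishinit : Bip → Set₁
ishinit A = (B : Bip) → iscontr (BipHom A B)

FibBip : Bip → Set₁
FibBip (A , a₀ , a₁) = Σ[ E ∈ (A → Set) ] (E a₀ × E a₁)

BipSec : (A : Bip) → FibBip A → Set
BipSec (A , a₀ , a₁) (E , e₀ , e₁) =
  Σ[ f ∈ ((x : A) → E x) ] ((f a₀ ≡ e₀) × (f a₁ ≡ e₁))

isind : Bip → Set₁
isind A = (E : FibBip A) → BipSec A E

-- Given a fibered bipointed type E over A, homotopy-initiality yields a morphism from A into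
-- the total space Σ A E; its first component is an endomorphism of A, hence equal to the
-- identity, and transporting the second component along that equality gives a section.
-- Conversely, induction into the constant family gives a morphism A → B, and induction into the
-- family of paths x ↦ f x ≡ g x gives a homotopy between any two morphisms f, g compatible
-- with the point paths, which function extensionality turns into an equality of morphisms.
module Submission where

open import Defs
open import Function using (_∘_)
open import Data.Product using (Σ; Σ-syntax; _×_; _,_; proj₁; proj₂)
open import Data.Product.Properties using (Σ-≡,≡←≡)
open import Relation.Binary.PropositionalEquality

iscontr⇒≡ : ∀ {ℓ} {X : Set ℓ} → iscontr X → (x y : X) → x ≡ y
iscontr⇒≡ (_ , centre≡) x y = trans (sym (centre≡ x)) (centre≡ y)

refl≡trans-sym⇒≡ : ∀ {ℓ} {X : Set ℓ} {x y : X} {p r : x ≡ y} → refl ≡ trans p (sym r) → p ≡ r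
refl≡trans-sym⇒≡ {p = p} {r = refl} e = trans (sym (trans-reflʳ p)) (sym e)

based-path-≡ : ∀ {ℓ} {X : Set ℓ} {x y : X} (q : x ≡ y) →
               _≡_ {A = Σ X (x ≡_)} (x , refl) (y , q)
based-path-≡ refl = refl

-- Naive function extensionality makes the type of homotopies out of f contractible (pointwise
-- it is a based path space), which justifies induction on homotopies.
homotopy-ind : FunExt → {A : Set} {B : A → Set} {f : (x : A) → B x}
               (P : (g : (x : A) → B x) → ((x : A) → f x ≡ g x) → Set) →
               P f (λ _ → refl) → {g : (x : A) → B x} (H : (x : A) → f x ≡ g x) → P g H
homotopy-ind fe {A} {B} {f} P P-refl {g} H = subst (λ (g , H) → P g H) to-homotopy P-refl
  where
  to-homotopy : _≡_ {A = Σ ((x : A) → B x) (λ g → (x : A) → f x ≡ g x)} (f , λ _ → refl) (g , H)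
  to-homotopy = cong (λ k → proj₁ ∘ k , proj₂ ∘ k)
                     (fe {B = λ x → Σ (B x) (f x ≡_)} (λ x → based-path-≡ (H x)))

module _ {A : Set} {a₀ a₁ : A} where

  Â : Bip
  Â = A , a₀ , a₁

  idᴮ : BipHom Â Â
  idᴮ = (λ x → x) , refl , refl

  totalᴮ : FibBip Â → Bip
  totalᴮ (E , e₀ , e₁) = Σ A E , (a₀ , e₀) , (a₁ , e₁)

  baseᴮ : (E : FibBip Â) → BipHom Â (totalᴮ E) → BipHom Â Â
  baseᴮ _ (h , q₀ , q₁) = proj₁ ∘ h , proj₁ (Σ-≡,≡←≡ q₀) , proj₁ (Σ-≡,≡←≡ q₁)

  -- Sections of E along an endomorphism φ; along idᴮ this is definitionally BipSec Â E.
  SecAlong : FibBip Â → BipHom Â Â → Set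
  SecAlong (E , e₀ , e₁) (φ , s₀ , s₁) =
    Σ[ G ∈ ((x : A) → E (φ x)) ] (subst E s₀ (G a₀) ≡ e₀ × subst E s₁ (G a₁) ≡ e₁)

  secAlong-baseᴮ : (E : FibBip Â) (h : BipHom Â (totalᴮ E)) → SecAlong E (baseᴮ E h)
  secAlong-baseᴮ _ (h , q₀ , q₁) = proj₂ ∘ h , proj₂ (Σ-≡,≡←≡ q₀) , proj₂ (Σ-≡,≡←≡ q₁)

  bipSec-from-baseᴮ≡idᴮ : (E : FibBip Â) (h : BipHom Â (totalᴮ E)) → baseᴮ E h ≡ idᴮ → BipSec Â E
  bipSec-from-baseᴮ≡idᴮ E h base≡id = subst (SecAlong E) base≡id (secAlong-baseᴮ E h)

  ishinit⇒isind : ishinit Â → isind Â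
  ishinit⇒isind hinit E =
    bipSec-from-baseᴮ≡idᴮ E h (iscontr⇒≡ (hinit Â) (baseᴮ E h) idᴮ)
    where
    h : BipHom Â (totalᴮ E)
    h = proj₁ (hinit (totalᴮ E))

  bipHom-≡ : FunExt → {B : Set} {b₀ b₁ : B} {f g : A → B}
             {p₀ : f a₀ ≡ b₀} {p₁ : f a₁ ≡ b₁} {r₀ : g a₀ ≡ b₀} {r₁ : g a₁ ≡ b₁}
             (H : (x : A) → f x ≡ g x) → H a₀ ≡ trans p₀ (sym r₀) → H a₁ ≡ trans p₁ (sym r₁) →
             _≡_ {A = BipHom Â (B , b₀ , b₁)} (f , p₀ , p₁) (g , r₀ , r₁)
  bipHom-≡ fe {B} {b₀} {b₁} {f} {p₀ = p₀} {p₁} {r₀} {r₁} H =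
    homotopy-ind fe Compatible⇒≡ refl-case H r₀ r₁
    where
    Compatible⇒≡ : (g : A → B) → ((x : A) → f x ≡ g x) → Set
    Compatible⇒≡ g H = (r₀ : g a₀ ≡ b₀) (r₁ : g a₁ ≡ b₁) →
      H a₀ ≡ trans p₀ (sym r₀) → H a₁ ≡ trans p₁ (sym r₁) →
      _≡_ {A = BipHom Â (B , b₀ , b₁)} (f , p₀ , p₁) (g , r₀ , r₁)

    refl-case : Compatible⇒≡ f (λ _ → refl)
    refl-case r₀ r₁ e₀ e₁ =
      cong₂ (λ u v → f , u , v) (refl≡trans-sym⇒≡ e₀) (refl≡trans-sym⇒≡ e₁)

  isind⇒bipHom-≡ : FunExt → isind Â → {B : Bip} (s t : BipHom Â B) → s ≡ t
  isind⇒bipHom-≡ fe ind (f , p₀ , p₁) (g , r₀ , r₁) =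
    let (H , e₀ , e₁) = ind ((λ x → f x ≡ g x) , trans p₀ (sym r₀) , trans p₁ (sym r₁))
    in  bipHom-≡ fe H e₀ e₁

  isind⇒ishinit : FunExt → isind Â → ishinit Â
  isind⇒ishinit fe ind (B , b₀ , b₁) = s , isind⇒bipHom-≡ fe ind s
    where
    s : BipHom Â (B , b₀ , b₁)
    s = ind ((λ _ → B) , b₀ , b₁)

theorem3p10 : FunExt → (A : Bip) → ishinit A ↔ isind A
theorem3p10 fe _ = ishinit⇒isind , isind⇒ishinit fe
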